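{- Let $A_e$ be the deterministic finite automaton with states $q_0,q_1,q_2$, initial state $q_0$ and edges $q_0\xrightarrow{\ell}q_1$ and $q_0\xrightarrow{h}q_2$, with $\Sigma_h=\{h\}$, $\Sigma_l=\{\ell\}$ and controllable actions $\Sigma_c=\{\ell,h\}$. There is no most permissive controller ensuring BSNNI for $A_e$, i.e. there is no controller $C$ such that $C(A_e)$ is BSNNI and $C'(\rho)\subseteq C(\rho)$ for every run $\rho$ of $A_e$ and every controller $C'$ with $C'(A_e)$ BSNNI.
   Context: For a finite automaton $A$ and $L\subseteq\Sigma$, $A/L$ relabels by $\varepsilon$ every edge labelled in $L$, and $A\backslash L$ deletes those edges. Write $s\xRightarrow{\varepsilon}s'$ for a (possibly empty) sequence of $\varepsilon$-steps and $\xRightarrow{a}=\xRightarrow{\varepsilon}\xrightarrow{a}\xRightarrow{\varepsilon}$. A weak simulation of $T_2$ by $T_1$ is a relation $\mathcal{R}$ relating the initial states such that whenever $s\,\mathcal{R}\,p$ and $p\xRightarrow{a}p'$ in $T_2$ ($a$ an action or $\varepsilon$) there is $s'$ with $s\xRightarrow{a}s'$ in $T_1$ and $s'\,\mathcal{R}\,p'$; $T_1,T_2$ are weakly bisimilar if there is a weak simulation $\mathcal{R}$ of $T_2$ by $T_1$ such that $\mathcal{R}^{ -1}$ is a weak simulation of $T_1$ by $T_2$. A system is BSNNI iff its $\backslash\Sigma_h$ and $/\Sigma_h$ versions are weakly bisimilar. Let $\Sigma_u=\Sigma\setminus\Sigma_c$. A controller maps each run $\rho$ of $A$ (finite path from the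 initial state) to a set $C(\rho)$ of enabled controllable actions; $C(A)$ is the system whose runs are defined inductively: the initial run is a run, and an extension $\rho\xrightarrow{e}q'$ (a run of $A$) of a run $\rho$ of $C(A)$ is a run of $C(A)$ iff $e\in\Sigma_u$ or $e\in\Sigma_c\cap C(\rho)$. -}

module Defs where

open import Data.Unit using (⊤)
open import Data.Empty using (⊥)
open import Data.Product using (Σ; ∃; _×_; _,_)
open import Data.Sum using (_⊎_)
open import Data.Maybe using (Maybe; just; nothing)
open import Relation.Nullary using (¬_)

data Act : Set where
  ℓ h : Act

data High : Act → Set where
  high : High h

data Low : Act → Set where
  low : Low ℓ

data Controllable : Act → Set where
  c-ℓ : Controllable ℓ
  c-h : Controllable h

Uncontrollable : Act → Set
Uncontrollable a = ¬ Controllable a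

data Q : Set where
  q0 q1 q2 : Q

data Edge : Q → Act → Q → Set where
  e-ℓ : Edge q0 ℓ q1
  e-h : Edge q0 h q2

data Run : Q → Set where
  start : Run q0
  snoc  : ∀ {q a q'} → Run q → Edge q a q' → Run q'

-- A controller maps each run to a set (predicate) of enabled actions
Controller : Set₁
Controller = ∀ {q} → Run q → Act → Set

data CRun (C : Controller) : ∀ {q} → Run q → Set where
  start : CRun C start
  snoc  : ∀ {q a q'} {ρ : Run q} → CRun C ρ → (e : Edge q a q') →
          (Uncontrollable a ⊎ (Controllable a × C ρ a)) →
          CRun C (snoc ρ e)

record ALTS : Set₁ where
  field
    State : Set
    init  : State
    Step  : State → Act → State → Set

-- systems with ε-labels (nothing = ε)
record LTS : Set₁ where
  field
    State : Set
    init  : State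
    Step  : State → Maybe Act → State → Set

-- C(A_e) as a system: states are the runs of C(A_e)
CState : Controller → Set
CState C = Σ Q λ q → Σ (Run q) λ ρ → CRun C ρ

data CStep (C : Controller) : CState C → Act → CState C → Set where
  step : ∀ {q a q'} {ρ : Run q} (r : CRun C ρ) (e : Edge q a q')
           (ok : Uncontrollable a ⊎ (Controllable a × C ρ a)) →
         CStep C (q , ρ , r) a (q' , snoc ρ e , snoc r e ok)

Controlled : Controller → ALTS
Controlled C = record { State = CState C ; init = (q0 , start , start) ; Step = CStep C }

-- T / L : relabel edges labelled in L by ε
hide : (Act → Set) → ALTS → LTS
hide L T = record { State = State ; init = init ; Step = st }
  where
  open ALTS T
  st : State → Maybe Act → State → Set
  st s nothing  s' = ∃ λ a → L a × Step s a s'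
  st s (just a) s' = ¬ L a × Step s a s'

-- T \ L : delete edges labelled in L
restrict : (Act → Set) → ALTS → LTS
restrict L T = record { State = State ; init = init ; Step = st }
  where
  open ALTS T
  st : State → Maybe Act → State → Set
  st s nothing  s' = ⊥
  st s (just a) s' = ¬ L a × Step s a s'

data EpsStar (T : LTS) : LTS.State T → LTS.State T → Set where
  ε-refl : ∀ {s} → EpsStar T s s
  ε-step : ∀ {s s' s''} → LTS.Step T s nothing s' → EpsStar T s' s'' → EpsStar T s s''

WeakStep : (T : LTS) → Maybe Act → LTS.State T → LTS.State T → Set
WeakStep T nothing  s s' = EpsStar T s s'
WeakStep T (just a) s s' =
  Σ (LTS.State T) λ s₁ → Σ (LTS.State T) λ s₂ →
    EpsStar T s s₁ × LTS.Step T s₁ (just a) s₂ × EpsStar T s₂ s'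

WeakSim : (T₁ T₂ : LTS) → (LTS.State T₁ → LTS.State T₂ → Set) → Set
WeakSim T₁ T₂ R =
  R (LTS.init T₁) (LTS.init T₂) ×
  (∀ s p α p' → R s p → WeakStep T₂ α p p' →
     Σ (LTS.State T₁) λ s' → WeakStep T₁ α s s' × R s' p')

WeakBisimilar : LTS → LTS → Set₁
WeakBisimilar T₁ T₂ =
  Σ (LTS.State T₁ → LTS.State T₂ → Set) λ R →
    WeakSim T₁ T₂ R × WeakSim T₂ T₁ (λ p s → R s p)

BSNNI : ALTS → Set₁
BSNNI T = WeakBisimilar (restrict High T) (hide High T)

-- Enabling only h at the root gives a system with no visible behaviour, and
-- enabling only ℓ gives one with no hidden behaviour; both are BSNNI, so a most
-- permissive controller would have to enable both actions at the root. But then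
-- the hidden h-move to the dead state q₂ can only be matched in C(A_e)\Σ_h by
-- staying at the root, where ℓ is still possible while q₂ can do nothing.
module Submission where

open import Defs
open import Data.Product using (Σ; _×_; _,_)
open import Data.Sum using (inj₁; inj₂)
open import Data.Unit using (⊤; tt)
open import Data.Empty using (⊥-elim)
open import Data.Maybe using (Maybe; just; nothing)
open import Relation.Nullary using (¬_)
open import Relation.Binary.PropositionalEquality using (_≡_; refl)

module _ (T : LTS) where
  open LTS T

  weakStep-visible-from-dead : ∀ {a s s'} → (∀ {α s''} → ¬ Step s α s'') →
                               ¬ WeakStep T (just a) s s'
  weakStep-visible-from-dead dead (_ , _ , ε-refl      , st , _) = dead st
  weakStep-visible-from-dead dead (_ , _ , ε-step st _ , _  , _) = dead st

  weakStep-visible-absent : (∀ {a s s'} → ¬ Step s (just a) s') →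
                            ∀ {a s s'} → ¬ WeakStep T (just a) s s'
  weakStep-visible-absent noVisible (_ , _ , _ , st , _) = noVisible st

  weakStep⇒step : (∀ {s s'} → EpsStar T s s' → s ≡ s') →
                  ∀ {a s s'} → WeakStep T (just a) s s' → Step s (just a) s'
  weakStep⇒step ε-trivial (_ , _ , e₁ , st , e₂) with ε-trivial e₁ | ε-trivial e₂
  ... | refl | refl = st

WeakSim-total : (T₁ T₂ : LTS) → (∀ {a s s'} → ¬ LTS.Step T₂ s (just a) s') →
                WeakSim T₁ T₂ (λ _ _ → ⊤)
WeakSim-total T₁ T₂ noVisible = tt , match
  where
  match : ∀ s p α p' → ⊤ → WeakStep T₂ α p p' →
          Σ (LTS.State T₁) λ s' → WeakStep T₁ α s s' × ⊤
  match s _ nothing  _ _ _ = s , ε-refl , tt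
  match _ _ (just a) _ _ w = ⊥-elim (weakStep-visible-absent T₂ noVisible w)

module _ (T : ALTS) where
  open ALTS T

  restrict-ε-trivial : ∀ {s s'} → EpsStar (restrict High T) s s' → s ≡ s'
  restrict-ε-trivial ε-refl       = refl
  restrict-ε-trivial (ε-step () _)

  hide-ε-trivial : (∀ {s s'} → ¬ Step s h s') →
                   ∀ {s s'} → EpsStar (hide High T) s s' → s ≡ s'
  hide-ε-trivial noHigh ε-refl                     = refl
  hide-ε-trivial noHigh (ε-step (_ , high , st) _) = ⊥-elim (noHigh st)

  BSNNI-withoutLowSteps : (∀ {s a s'} → ¬ High a → ¬ Step s a s') → BSNNI T
  BSNNI-withoutLowSteps noLow =
    (λ _ _ → ⊤) , WeakSim-total _ _ noVisible , WeakSim-total _ _ noVisible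
    where
    noVisible : ∀ {a s s'} → ¬ (¬ High a × Step s a s')
    noVisible (notHigh , st) = noLow notHigh st

  BSNNI-withoutHighSteps : (∀ {s s'} → ¬ Step s h s') → BSNNI T
  BSNNI-withoutHighSteps noHigh = _≡_ , (refl , matchHide) , (refl , matchRestrict)
    where
    matchHide : ∀ s p α p' → s ≡ p → WeakStep (hide High T) α p p' →
                Σ State λ s' → WeakStep (restrict High T) α s s' × s' ≡ p'
    matchHide s _ nothing _ refl w with hide-ε-trivial noHigh w
    ... | refl = s , ε-refl , refl
    matchHide s _ (just a) p' refl w =
      p' , (s , p' , ε-refl , weakStep⇒step _ (hide-ε-trivial noHigh) w , ε-refl) , refl

    matchRestrict : ∀ p s α s' → s ≡ p → WeakStep (restrict High T) α s s' →
                    Σ State λ p' → WeakStep (hide High T) α p p' × s' ≡ p'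
    matchRestrict p _ nothing _ refl w with restrict-ε-trivial w
    ... | refl = p , ε-refl , refl
    matchRestrict p _ (just a) s' refl w =
      s' , (p , s' , ε-refl , weakStep⇒step _ restrict-ε-trivial w , ε-refl) , refl

all-controllable : ∀ a → Controllable a
all-controllable ℓ = c-ℓ
all-controllable h = c-h

CStep⇒enabled : ∀ {C : Controller} {q a s'} {ρ : Run q} {r : CRun C ρ} → CStep C (q , ρ , r) a s' → C ρ a
CStep⇒enabled {a = a} (step _ _ (inj₁ uncontrollable)) = ⊥-elim (uncontrollable (all-controllable a))
CStep⇒enabled (step _ _ (inj₂ (_ , enabled)))           = enabled

CStep-from-q₂ : ∀ {C : Controller} {a s'} {ρ : Run q2} {r : CRun C ρ} → ¬ CStep C (q2 , ρ , r) a s'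
CStep-from-q₂ (step _ () _)

enableHigh : Controller
enableHigh _ a = a ≡ h

enableLow : Controller
enableLow _ a = a ≡ ℓ

BSNNI-enableHigh : BSNNI (Controlled enableHigh)
BSNNI-enableHigh = BSNNI-withoutLowSteps _ noLow
  where
  noLow : ∀ {s a s'} → ¬ High a → ¬ CStep enableHigh s a s'
  noLow {_ , _ , _} notHigh st with CStep⇒enabled st
  ... | refl = notHigh high

BSNNI-enableLow : BSNNI (Controlled enableLow)
BSNNI-enableLow = BSNNI-withoutHighSteps _ noHigh
  where
  noHigh : ∀ {s s'} → ¬ CStep enableLow s h s'
  noHigh {_ , _ , _} st with CStep⇒enabled st
  ... | ()

module _ (C : Controller) (enabledHigh : C start h) (enabledLow : C start ℓ) where
  private
    root afterHigh afterLow : CState C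
    root      = q0 , start , start
    afterHigh = q2 , snoc start e-h , snoc start e-h (inj₂ (c-h , enabledHigh))
    afterLow  = q1 , snoc start e-ℓ , snoc start e-ℓ (inj₂ (c-ℓ , enabledLow))

    rootHidesHigh : EpsStar (hide High (Controlled C)) root afterHigh
    rootHidesHigh = ε-step (h , high , step start e-h (inj₂ (c-h , enabledHigh))) ε-refl

    rootShowsLow : WeakStep (restrict High (Controlled C)) (just ℓ) root afterLow
    rootShowsLow = root , afterLow , ε-refl ,
                   ((λ ()) , step start e-ℓ (inj₂ (c-ℓ , enabledLow))) , ε-refl

    afterHigh-dead : ∀ {α : Maybe Act} {s} → ¬ LTS.Step (hide High (Controlled C)) afterHigh α s
    afterHigh-dead {nothing} (_ , _ , st) = CStep-from-q₂ st
    afterHigh-dead {just _}  (_ , st)     = CStep-from-q₂ st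

  ¬BSNNI-enablingBoth : ¬ BSNNI (Controlled C)
  ¬BSNNI-enablingBoth (R , (R-init , matchHide) , (_ , matchRestrict))
    with matchHide root root nothing afterHigh R-init rootHidesHigh
  ... | _ , stay , R-root-afterHigh with restrict-ε-trivial _ stay
  ... | refl with matchRestrict afterHigh root (just ℓ) afterLow R-root-afterHigh rootShowsLow
  ... | _ , w , _ = weakStep-visible-from-dead _ afterHigh-dead w

proposition5 : ¬ (Σ Controller λ C →
                 BSNNI (Controlled C) ×
                 (∀ (C' : Controller) → BSNNI (Controlled C') →
                    ∀ {q} (ρ : Run q) (a : Act) → C' ρ a → C ρ a))
proposition5 (C , bsnni , mostPermissive) =
  ¬BSNNI-enablingBoth C
    (mostPermissive enableHigh BSNNI-enableHigh start h refl)
    (mostPermissive enableLow  BSNNI-enableLow  start ℓ refl)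
    bsnni
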